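{- Let $H$ be a Heyting algebra, $f : H \to H$ a strong monotone function and $a \in H$. If the least fixed point $\mu.f$ of $f$ exists, then the least fixed points of $x \mapsto a \to f(x)$ and of $x \mapsto a \land f(x)$ exist and $$\mu.(a \to f) = a \to \mu.f, \qquad \mu.(a \land f) = a \land \mu.f.$$
   Context: A monotone function $f : H \to H$ on a Heyting algebra is strong if $x \land f(y) \leq f(x \land y)$ for all $x,y \in H$. For a monotone map $g$, $\mu.g$ denotes its least prefixed point (the least $p$ with $g(p) \leq p$), which is then its least fixed point; $H$ is not assumed complete. -}

module Defs where

open import Level using (Level)
open import Data.Product using (_×_)
open import Relation.Binary.Lattice.Bundles using (HeytingAlgebra)

module _ {c ℓ₁ ℓ₂ : Level} (H : HeytingAlgebra c ℓ₁ ℓ₂) where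
  open HeytingAlgebra H

  Monotone : (Carrier → Carrier) → Set _
  Monotone f = ∀ {x y} → x ≤ y → f x ≤ f y

  Strong : (Carrier → Carrier) → Set _
  Strong f = ∀ x y → (x ∧ f y) ≤ f (x ∧ y)

  -- p is the least prefixed point of g (i.e. p = μ.g):
  -- g p ≤ p, and p ≤ q for every q with g q ≤ q
  IsLeastPrefixedPoint : (Carrier → Carrier) → Carrier → Set _
  IsLeastPrefixedPoint g p = (g p ≤ p) × (∀ q → g q ≤ q → p ≤ q)

-- Strength gives a ∧ f (a ⇨ x) ≤ f x, i.e. f (a ⇨ x) ≤ a ⇨ f x. Hence a ⇨ μ.f is a
-- prefixed point of a ⇨ f, and for any prefixed point q of a ∧ f, the element a ⇨ q is a
-- prefixed point of f, so μ.f ≤ a ⇨ q. The remaining inequalities only use that μ.f is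
-- a fixed point of f.
module Submission where

open import Defs
open import Level using (Level)
open import Data.Product using (_×_; _,_)
open import Relation.Binary.Lattice.Bundles using (HeytingAlgebra)
import Relation.Binary.Lattice.Properties.HeytingAlgebra as HeytingAlgebraProperties
import Relation.Binary.Reasoning.PartialOrder as PosetReasoning

module _ {c ℓ₁ ℓ₂ : Level} (H : HeytingAlgebra c ℓ₁ ℓ₂) where
  open HeytingAlgebra H
  open HeytingAlgebraProperties H using (swap-transpose-⇨; y≤x⇨y; ⇨ʳ-covariant; ⇨-applyʳ)
  open PosetReasoning poset

  leastPrefixedPoint⇒postfixed : ∀ {g p} → Monotone H g →
                                 IsLeastPrefixedPoint H g p → p ≤ g p
  leastPrefixedPoint⇒postfixed {g} {p} mono (gp≤p , least) = least (g p) (mono gp≤p)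

  ∧-monotoneʳ : ∀ a → Monotone H (a ∧_)
  ∧-monotoneʳ a x≤y = ∧-greatest (x∧y≤x _ _) (trans (x∧y≤y _ _) x≤y)

  ∧-⇨-eval : ∀ a x → a ∧ (a ⇨ x) ≤ a ∧ x
  ∧-⇨-eval a x = ∧-greatest (x∧y≤x _ _) (⇨-applyʳ refl)

  module _ {f : Carrier → Carrier} (mono : Monotone H f) (strong : Strong H f) where

    strong-⇨-eval : ∀ a x → a ∧ f (a ⇨ x) ≤ f x
    strong-⇨-eval a x = begin
      a ∧ f (a ⇨ x)  ≤⟨ strong a (a ⇨ x) ⟩
      f (a ∧ (a ⇨ x)) ≤⟨ mono (⇨-applyʳ refl) ⟩
      f x             ∎

    ⇨-leastPrefixedPoint : ∀ a {μf} → IsLeastPrefixedPoint H f μf →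
                           IsLeastPrefixedPoint H (λ x → a ⇨ f x) (a ⇨ μf)
    ⇨-leastPrefixedPoint a {μf} lpp@(fμf≤μf , least) = prefixed , leastAmongPrefixed
      where
      prefixed : a ⇨ f (a ⇨ μf) ≤ a ⇨ μf
      prefixed = swap-transpose-⇨ (begin
        a ∧ (a ⇨ f (a ⇨ μf)) ≤⟨ ∧-⇨-eval a _ ⟩
        a ∧ f (a ⇨ μf)       ≤⟨ strong-⇨-eval a μf ⟩
        f μf                 ≤⟨ fμf≤μf ⟩
        μf                   ∎)

      leastAmongPrefixed : ∀ q → a ⇨ f q ≤ q → a ⇨ μf ≤ q
      leastAmongPrefixed q a⇨fq≤q = begin
        a ⇨ μf   ≤⟨ ⇨ʳ-covariant (leastPrefixedPoint⇒postfixed mono lpp) ⟩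
        a ⇨ f μf ≤⟨ ⇨ʳ-covariant (mono μf≤q) ⟩
        a ⇨ f q  ≤⟨ a⇨fq≤q ⟩
        q        ∎
        where
        μf≤q : μf ≤ q
        μf≤q = least q (trans y≤x⇨y a⇨fq≤q)

    ∧-leastPrefixedPoint : ∀ a {μf} → IsLeastPrefixedPoint H f μf →
                           IsLeastPrefixedPoint H (λ x → a ∧ f x) (a ∧ μf)
    ∧-leastPrefixedPoint a {μf} (fμf≤μf , least) = prefixed , leastAmongPrefixed
      where
      prefixed : a ∧ f (a ∧ μf) ≤ a ∧ μf
      prefixed = ∧-monotoneʳ a (trans (mono (x∧y≤y _ _)) fμf≤μf)

      leastAmongPrefixed : ∀ q → a ∧ f q ≤ q → a ∧ μf ≤ q
      leastAmongPrefixed q a∧fq≤q = begin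
        a ∧ μf       ≤⟨ ∧-monotoneʳ a (least (a ⇨ q) a⇨q-prefixed) ⟩
        a ∧ (a ⇨ q)  ≤⟨ ⇨-applyʳ refl ⟩
        q            ∎
        where
        a⇨q-prefixed : f (a ⇨ q) ≤ a ⇨ q
        a⇨q-prefixed = swap-transpose-⇨ (begin
          a ∧ f (a ⇨ q) ≤⟨ ∧-greatest (x∧y≤x _ _) (strong-⇨-eval a q) ⟩
          a ∧ f q       ≤⟨ a∧fq≤q ⟩
          q             ∎)

proposition3p5 : {c ℓ₁ ℓ₂ : Level} (H : HeytingAlgebra c ℓ₁ ℓ₂)
    (f : HeytingAlgebra.Carrier H → HeytingAlgebra.Carrier H)
    → Monotone H f → Strong H f
    → (a μf : HeytingAlgebra.Carrier H)
    → IsLeastPrefixedPoint H f μf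
    → IsLeastPrefixedPoint H (λ x → HeytingAlgebra._⇨_ H a (f x)) (HeytingAlgebra._⇨_ H a μf)
    × IsLeastPrefixedPoint H (λ x → HeytingAlgebra._∧_ H a (f x)) (HeytingAlgebra._∧_ H a μf)
proposition3p5 H f mono strong a μf lpp =
  ⇨-leastPrefixedPoint H mono strong a lpp , ∧-leastPrefixedPoint H mono strong a lpp
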